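{- Let $T$ be a $2$-primitive set and $p$ a prime. Let $T^p=\{t\in T: P(t)=p\}$ and, for real $z$, let $N_p(z)$ be the number of $t\in T^p$ with $t\le z$. Then for every real $z>1$, \[ N_p(z) \le z^{1/2} - \sum_{q\in I_p} \Big\lfloor \frac{z^{1/2}}{q}\Big\rfloor, \] where $q$ runs over the primes in the interval $I_p=(\max\{p, z^{1/4}\}, z^{1/2})$.
   Context: A set $T$ of integers greater than $1$ with $|T|\ge 3$ is called $2$-primitive if no element of $T$ divides the product of $2$ distinct other elements of $T$. $P(t)$ denotes the greatest prime factor of $t$.
   Formalization: The parameter z ranges over the rationals with $z>1$ rather than over the reals. -}

module Defs where

open import Data.Nat using (ℕ; suc; _+_; _*_; _≤_; _<_; _^_)
open import Data.Nat.Divisibility using (_∣_)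
open import Data.Nat.Primality using (Prime; prime?)
open import Data.Integer using (+_; ∣_∣)
open import Data.Rational using (ℚ; _/_; floor) renaming (_≤_ to _≤ℚ_; _<_ to _<ℚ_; _*_ to _*ℚ_)
open import Data.Rational.Properties using () renaming (_≤?_ to _≤ℚ?_; _<?_ to _<ℚ?_)
open import Data.Nat.Properties using () renaming (_<?_ to _<ℕ?_)
open import Data.List using (List; length; filter; map; upTo)
open import Data.Nat.ListAction using (sum)
open import Data.Product using (_×_; ∃)
open import Relation.Nullary using (¬_)
open import Relation.Nullary.Decidable using (_×-dec_)
open import Relation.Binary.PropositionalEquality using (_≢_)

⟦_⟧ : ℕ → ℚ
⟦ m ⟧ = (+ m) / 1

AllGt1 : (ℕ → Set) → Set
AllGt1 T = ∀ t → T t → 1 < t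

AtLeast3 : (ℕ → Set) → Set
AtLeast3 T = ∃ λ a → ∃ λ b → ∃ λ c →
  T a × T b × T c × a ≢ b × a ≢ c × b ≢ c

TwoPrimitive : (ℕ → Set) → Set
TwoPrimitive T = ∀ a b c → T a → T b → T c →
  a ≢ b → a ≢ c → b ≢ c → ¬ (a ∣ b * c)

GreatestPrimeFactor : ℕ → ℕ → Set
GreatestPrimeFactor t p = Prime p × p ∣ t × (∀ r → Prime r → r ∣ t → r ≤ p)

-- ⌊z⌋ as a natural number (z > 1 in the application)
⌊_⌋ℕ : ℚ → ℕ
⌊ z ⌋ℕ = ∣ floor z ∣

-- ⌊ z^{1/2} / q ⌋ = #{ k ≥ 1 : k ≤ z^{1/2}/q } = #{ k ≥ 1 : (k q)^2 ≤ z };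
-- all such k satisfy k ≤ z^{1/2} ≤ ⌊z⌋ when z ≥ 1 and q ≥ 1.
floorSqrtDiv : ℚ → ℕ → ℕ
floorSqrtDiv z q =
  length (filter (λ k → ⟦ (k * q) ^ 2 ⟧ ≤ℚ? z) (map suc (upTo ⌊ z ⌋ℕ)))

-- primes q in I_p = (max{p, z^{1/4}}, z^{1/2}):  p < q,  z < q^4,  q^2 < z.
-- All such q are < z^{1/2} ≤ ⌊z⌋ + 1.
primesInI : ℕ → ℚ → List ℕ
primesInI p z =
  filter (λ q → prime? q ×-dec (p <ℕ? q) ×-dec (z <ℚ? ⟦ q ^ 4 ⟧) ×-dec (⟦ q ^ 2 ⟧ <ℚ? z))
         (upTo (suc ⌊ z ⌋ℕ))

sumI : ℕ → ℚ → ℕ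
sumI p z = sum (map (floorSqrtDiv z) (primesInI p z))

{-# OPTIONS --safe #-}
module Submission where

-- Let Z = ⌊z⌋. The prime factors of t / p (t ∈ T^p, t ≤ z) are at most p, so they can be
-- distributed greedily into t = p·u·v with u² ≤ Z and v² ≤ Z. Reading {u, v} as an edge of a
-- multigraph, 2-primitivity says that no edge has both endpoints on other edges (p·a·b divides
-- p·a·c · p·b·d), so some edge always has a private endpoint; removing edges one at a time
-- injects T^p ∩ [1, z] into the vertices. The numbers k·q with q a prime of I_p and (kq)² ≤ Z
-- are further vertices: they have the prime factor q > p, so they lie on no edge, and since
-- q⁴ > Z a number has at most one such representation. So N_p(z) + Σ ⌊z^{1/2}/q⌋ distinct
-- positive numbers have square at most Z.

open import Defs
open import Data.Nat
  using (ℕ; zero; suc; _+_; _*_; _^_; _≤_; _<_; z≤n; s≤s; _≟_; _≤?_;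
         NonZero; >-nonZero; >-nonZero⁻¹; nonTrivial⇒≢1)
open import Data.Nat.Properties
open import Data.Nat.Divisibility
open import Data.Nat.DivMod using (_/_; m≥n⇒m/n>0; m*n/n≡m; m/n*n≤m; /-monoˡ-≤; m*[n/m]≡n)
open import Data.Nat.Coprimality using (Coprime; 1-coprimeTo) renaming (sym to coprime-sym)
open import Data.Nat.Primality
  using (Prime; prime?; prime⇒nonZero; prime⇒nonTrivial; prime⇒irreducible; euclidsLemma)
open import Data.Nat.Primality.Factorisation using (factorise; PrimeFactorisation)
open import Data.Nat.ListAction using (sum; product)
open import Data.Nat.ListAction.Properties using (∈⇒∣product)
open import Data.Nat.Tactic.RingSolver using (solve-∀)
open import Algebra.Properties.CommutativeSemigroup *-commutativeSemigroup using (x∙yz≈y∙xz)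
open import Data.Integer as ℤ using (+_; -[1+_])
import Data.Integer.Properties as ℤ
open import Data.Rational using (ℚ; mkℚ; 0ℚ; 1ℚ) renaming (_≤_ to _≤ℚ_; _<_ to _<ℚ_)
open import Data.Rational.Base using (*≤*)
import Data.Rational.Properties as ℚ
open import Data.List using (List; []; _∷_; _++_; length; map; filter; upTo; concatMap; foldr)
open import Data.List.Properties using (length-++; length-map; length-upTo)
open import Data.List.Relation.Unary.All as All using (All; []; _∷_)
import Data.List.Relation.Unary.All.Properties as All
open import Data.List.Relation.Unary.Any as Any using (Any; here; there)
open import Data.List.Relation.Unary.AllPairs as AllPairs using ([]; _∷_)
open import Data.List.Relation.Unary.Unique.Propositional using (Unique)
import Data.List.Relation.Unary.Unique.Propositional.Properties as Unique
open import Data.List.Membership.Propositional using (_∈_; find; lose)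
open import Data.List.Membership.Propositional.Properties
  using (∈-∃++; ∈-map⁻; ∈-filter⁻; ∈-upTo⁺; ∈-concatMap⁻)
open import Data.List.Relation.Binary.Subset.Propositional using (_⊆_)
open import Data.List.Relation.Binary.Subset.Propositional.Properties using (Any-resp-⊆)
open import Data.List.Relation.Binary.Permutation.Propositional using (_↭_; ↭-sym; ↭⇒↭ₛ)
open import Data.List.Relation.Binary.Permutation.Propositional.Properties
  using (shift; ↭-length; ∈-resp-↭; All-resp-↭)
import Data.List.Relation.Binary.Permutation.Setoid.Properties as Permutationₛ
open import Data.Product using (_×_; _,_; ∃; proj₁; proj₂)
open import Data.Sum using (_⊎_; inj₁; inj₂)
open import Function using (_∘_)
open import Relation.Nullary using (¬_; Dec; yes; no; contradiction)
open import Relation.Nullary.Decidable using (_×-dec_; _⊎-dec_; ¬?)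
open import Relation.Binary.PropositionalEquality

∈⇒↭ : ∀ {A : Set} {x : A} {xs} → x ∈ xs → ∃ λ ys → xs ↭ x ∷ ys
∈⇒↭ x∈xs with as , bs , refl ← ∈-∃++ x∈xs = as ++ bs , shift _ as bs

↭∷⇒⊆ : ∀ {A : Set} {xs ys : List A} {x} → xs ↭ x ∷ ys → ys ⊆ xs
↭∷⇒⊆ σ y∈ys = ∈-resp-↭ (↭-sym σ) (there y∈ys)

unique-↭ : ∀ {A : Set} {xs ys : List A} → xs ↭ ys → Unique xs → Unique ys
unique-↭ {A} σ = Permutationₛ.Unique-resp-↭ (setoid A) (↭⇒↭ₛ σ)

unique-⊆⇒length≤ : ∀ {A : Set} {xs ys : List A} → Unique xs → xs ⊆ ys → length xs ≤ length ys
unique-⊆⇒length≤ {xs = []} _ _ = z≤n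
unique-⊆⇒length≤ {xs = x ∷ xs} {ys} (x∉xs ∷ uniq) xs⊆ys with ys′ , σ ← ∈⇒↭ (xs⊆ys (here refl)) =
  begin
    suc (length xs)  ≤⟨ s≤s (unique-⊆⇒length≤ uniq xs⊆ys′) ⟩
    suc (length ys′) ≡⟨ sym (↭-length σ) ⟩
    length ys        ∎
  where
  open ≤-Reasoning
  xs⊆ys′ : xs ⊆ ys′
  xs⊆ys′ y∈xs with ∈-resp-↭ σ (xs⊆ys (there y∈xs))
  ... | here refl   = contradiction refl (All.lookup x∉xs y∈xs)
  ... | there y∈ys′ = y∈ys′

-- Otherwise 0 ∷ ws would be a duplicate-free list of length n + 1 below n = length ws.
length²≤ : ∀ {Z} ws → Unique ws → All (λ w → 0 < w × w * w ≤ Z) ws → length ws * length ws ≤ Z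
length²≤ {Z} ws uniq bounds with length ws * length ws ≤? Z
... | yes n²≤Z = n²≤Z
... | no n²≰Z  = contradiction
      (subst (suc n ≤_) (length-upTo n) (unique-⊆⇒length≤ (All.map (<⇒≢ ∘ proj₁) bounds ∷ uniq) 0∷ws⊆))
      (<-irrefl refl)
  where
  n = length ws
  below : ∀ {w} → w * w ≤ Z → w < n
  below w²≤Z = ≰⇒> λ n≤w → n²≰Z (≤-trans (*-mono-≤ n≤w n≤w) w²≤Z)
  0∷ws⊆ : 0 ∷ ws ⊆ upTo n
  0∷ws⊆ (here refl)  = ∈-upTo⁺ (below {0} z≤n)
  0∷ws⊆ (there w∈ws) = ∈-upTo⁺ (below (proj₂ (All.lookup bounds w∈ws)))

∣⇒>0 : ∀ {m n} → m ∣ n → 0 < n → 0 < m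
∣⇒>0 {zero}  0∣n 0<n = contradiction (0∣⇒≡0 0∣n) (>⇒≢ 0<n)
∣⇒>0 {suc _} _   _   = s≤s z≤n

Smooth : ℕ → ℕ → Set
Smooth p n = ∀ r → Prime r → r ∣ n → r ≤ p

smooth-∣ : ∀ {p m n} → m ∣ n → Smooth p n → Smooth p m
smooth-∣ m∣n smooth r r-prime r∣m = smooth r r-prime (∣-trans r∣m m∣n)

-- The junk value at 0 is [].
primeFactors : ℕ → List ℕ
primeFactors zero      = []
primeFactors n@(suc _) = PrimeFactorisation.factors (factorise n)

product-primeFactors : ∀ n .{{_ : NonZero n}} → product (primeFactors n) ≡ n
product-primeFactors n@(suc _) = sym (PrimeFactorisation.isFactorisation (factorise n))

primeFactors-prime : ∀ n → All Prime (primeFactors n)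
primeFactors-prime zero      = []
primeFactors-prime n@(suc _) = PrimeFactorisation.factorsPrime (factorise n)

distinctPrimes-*∣ : ∀ {q q′ w} → Prime q → Prime q′ → q ≢ q′ → q ∣ w → q′ ∣ w → q * q′ ∣ w
distinctPrimes-*∣ {q} {q′} q-prime q′-prime q≢q′ q∣w (divides k refl)
  with euclidsLemma k q′ q-prime q∣w
... | inj₁ q∣k  = *-monoˡ-∣ q′ q∣k
... | inj₂ q∣q′ with prime⇒irreducible q′-prime q∣q′
...   | inj₁ q≡1  = contradiction q≡1 (nonTrivial⇒≢1 {{prime⇒nonTrivial q-prime}})
...   | inj₂ q≡q′ = contradiction q≡q′ q≢q′

-- Two such primes would give (q * q′)² ≤ w² ≤ Z, while q⁴ * q′⁴ > Z².
largePrimeDivisor-unique : ∀ {Z q q′ w} → Prime q → Prime q′ →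
  Z < (q * q) * (q * q) → Z < (q′ * q′) * (q′ * q′) →
  q ∣ w → q′ ∣ w → 0 < w → w * w ≤ Z → q ≡ q′
largePrimeDivisor-unique {Z} {q} {q′} {w} q-prime q′-prime Z<q⁴ Z<q′⁴ q∣w q′∣w 0<w w²≤Z
  with q ≟ q′
... | yes q≡q′ = q≡q′
... | no q≢q′  = contradiction (begin-strict
  Z * Z                                           <⟨ *-mono-< Z<q⁴ Z<q′⁴ ⟩
  (q * q) * (q * q) * ((q′ * q′) * (q′ * q′))     ≡⟨ regroup q q′ ⟩
  (q * q′) * (q * q′) * ((q * q′) * (q * q′))     ≤⟨ *-mono-≤ [qq′]²≤w² [qq′]²≤w² ⟩
  (w * w) * (w * w)                               ≤⟨ *-mono-≤ w²≤Z w²≤Z ⟩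
  Z * Z                                           ∎) (<-irrefl refl)
  where
  open ≤-Reasoning
  qq′≤w : q * q′ ≤ w
  qq′≤w = ∣⇒≤ {{>-nonZero 0<w}} (distinctPrimes-*∣ q-prime q′-prime q≢q′ q∣w q′∣w)
  [qq′]²≤w² : (q * q′) * (q * q′) ≤ w * w
  [qq′]²≤w² = *-mono-≤ qq′≤w qq′≤w
  regroup : ∀ q q′ → (q * q) * (q * q) * ((q′ * q′) * (q′ * q′)) ≡ (q * q′) * (q * q′) * ((q * q′) * (q * q′))
  regroup = solve-∀

twoPrimitive-⊆ : ∀ {S T : ℕ → Set} → TwoPrimitive T → (∀ {x} → S x → T x) → TwoPrimitive S
twoPrimitive-⊆ prim S⊆T a b c Sa Sb Sc = prim a b c (S⊆T Sa) (S⊆T Sb) (S⊆T Sc)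

-- Each t is read as the edge {u t, v t} of a multigraph on ℕ.
module Endpoints (c : ℕ) (u v : ℕ → ℕ) where

  Endpoint : ℕ → ℕ → Set
  Endpoint t x = x ≡ u t ⊎ x ≡ v t

  endpoint? : ∀ t x → Dec (Endpoint t x)
  endpoint? t x = (x ≟ u t) ⊎-dec (x ≟ v t)

  EndpointIn : List ℕ → ℕ → Set
  EndpointIn ts x = Any (λ t → Endpoint t x) ts

  SharedIn : List ℕ → ℕ → ℕ → Set
  SharedIn ts t x = Any (λ t′ → t′ ≢ t × Endpoint t′ x) ts

  sharedIn? : ∀ ts t x → Dec (SharedIn ts t x)
  sharedIn? ts t x = Any.any? (λ t′ → ¬? (t′ ≟ t) ×-dec endpoint? t′ x) ts

  HasPrivateEndpoint : List ℕ → ℕ → Set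
  HasPrivateEndpoint ts t = ∃ λ x → Endpoint t x × ¬ SharedIn ts t x

  Factored : ℕ → Set
  Factored t = t ≡ c * (u t * v t)

  factored-injective : ∀ {t t′} → Factored t → Factored t′ → u t * v t ≡ u t′ * v t′ → t ≡ t′
  factored-injective fac fac′ eq = trans fac (trans (cong (c *_) eq) (sym fac′))

  endpoint-∣ : ∀ {t x} → Factored t → Endpoint t x → x ∣ t
  endpoint-∣ {t} fac (inj₁ refl) = subst (u t ∣_) (sym fac) (∣-trans (m∣m*n (v t)) (n∣m*n c))
  endpoint-∣ {t} fac (inj₂ refl) = subst (v t ∣_) (sym fac) (∣-trans (n∣m*n (u t)) (n∣m*n c))

  coendpoint : ∀ {t x} → Endpoint t x → ∃ λ y → u t * v t ≡ x * y
  coendpoint {t} (inj₁ refl) = v t , refl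
  coendpoint {t} (inj₂ refl) = u t , *-comm (u t) (v t)

  distinct-endpoints : ∀ {t x y} → Endpoint t x → Endpoint t y → x ≢ y → u t * v t ≡ x * y
  distinct-endpoints     (inj₁ refl) (inj₁ refl) x≢y = contradiction refl x≢y
  distinct-endpoints     (inj₁ refl) (inj₂ refl) _   = refl
  distinct-endpoints {t} (inj₂ refl) (inj₁ refl) _   = *-comm (u t) (v t)
  distinct-endpoints     (inj₂ refl) (inj₂ refl) x≢y = contradiction refl x≢y

  loop-endpoint : ∀ {t x} → u t ≡ v t → Endpoint t x → u t ≡ x
  loop-endpoint _    (inj₁ refl) = refl
  loop-endpoint loop (inj₂ refl) = loop

  loops-product : ∀ {t t′} → u t ≡ v t → u t′ ≡ v t′ → Endpoint t′ (u t) → u t′ * v t′ ≡ u t * v t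
  loops-product loop loop′ e = cong₂ _*_ u′≡u (trans (sym loop′) (trans u′≡u loop))
    where
    u′≡u = loop-endpoint loop′ e

  c[ab]∣c[ad]*c[be] : ∀ a b d e → c * (a * b) ∣ c * (a * d) * (c * (b * e))
  c[ab]∣c[ad]*c[be] a b d e = divides (c * (d * e)) (regroup c a b d e)
    where
    regroup : ∀ c a b d e → c * (a * d) * (c * (b * e)) ≡ c * (d * e) * (c * (a * b))
    regroup = solve-∀

  module _ {ts} (prim : TwoPrimitive (_∈ ts)) (facs : All Factored ts) where

    private
      fac : ∀ {t} → t ∈ ts → Factored t
      fac = All.lookup facs

    -- Otherwise t = c·(u t)·(v t) divides t₁ * t₂ = c·(u t)·w₁ · c·(v t)·w₂.
    ¬covered : ∀ {t t₁ t₂} → t ∈ ts → t₁ ∈ ts → t₂ ∈ ts → t₁ ≢ t → t₂ ≢ t → t₁ ≢ t₂ →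
               ¬ (Endpoint t₁ (u t) × Endpoint t₂ (v t))
    ¬covered {t} {t₁} {t₂} t∈ t₁∈ t₂∈ t₁≢t t₂≢t t₁≢t₂ (e₁ , e₂) =
      prim t t₁ t₂ t∈ t₁∈ t₂∈ (≢-sym t₁≢t) (≢-sym t₂≢t) t₁≢t₂ t∣t₁t₂
      where
      w₁ = proj₁ (coendpoint e₁)
      w₂ = proj₁ (coendpoint e₂)
      t∣t₁t₂ : t ∣ t₁ * t₂
      t∣t₁t₂ = subst₂ _∣_
        (sym (fac t∈))
        (sym (cong₂ _*_ (trans (fac t₁∈) (cong (c *_) (proj₂ (coendpoint e₁))))
                        (trans (fac t₂∈) (cong (c *_) (proj₂ (coendpoint e₂))))))
        (c[ab]∣c[ad]*c[be] (u t) (v t) w₁ w₂)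

    -- By ¬covered both endpoints can only be shared with one and the same t₁,
    -- which then has the same endpoints as t and so equals t.
    nonLoop⇒privateEndpoint : ∀ {t} → t ∈ ts → u t ≢ v t → HasPrivateEndpoint ts t
    nonLoop⇒privateEndpoint {t} t∈ u≢v with sharedIn? ts t (u t) | sharedIn? ts t (v t)
    ... | no ¬shared | _          = u t , inj₁ refl , ¬shared
    ... | yes _      | no ¬shared = v t , inj₂ refl , ¬shared
    ... | yes su     | yes sv
      with t₁ , t₁∈ , t₁≢t , e₁ ← find su | t₂ , t₂∈ , t₂≢t , e₂ ← find sv | t₁ ≟ t₂
    ...   | no t₁≢t₂ = contradiction (e₁ , e₂) (¬covered t∈ t₁∈ t₂∈ t₁≢t t₂≢t t₁≢t₂)
    ...   | yes refl =
      contradiction (factored-injective (fac t₁∈) (fac t∈) (distinct-endpoints e₁ e₂ u≢v)) t₁≢t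

    -- A loop t whose vertex is shared with t₁ hands over to t₁, which cannot be a loop as well.
    privateEndpoint : ∀ {t} → t ∈ ts → ∃ λ t′ → t′ ∈ ts × HasPrivateEndpoint ts t′
    privateEndpoint {t} t∈ with u t ≟ v t
    ... | no u≢v = t , t∈ , nonLoop⇒privateEndpoint t∈ u≢v
    ... | yes loop with sharedIn? ts t (u t)
    ...   | no ¬shared = t , t∈ , u t , inj₁ refl , ¬shared
    ...   | yes shared with t₁ , t₁∈ , t₁≢t , e₁ ← find shared =
      t₁ , t₁∈ , nonLoop⇒privateEndpoint t₁∈ λ loop₁ →
        t₁≢t (factored-injective (fac t₁∈) (fac t∈) (loops-product loop loop₁ e₁))

  private
    private⇒fresh : ∀ {ts t rest x ys} → ts ↭ t ∷ rest → Unique ts → ¬ SharedIn ts t x →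
                    All (EndpointIn rest) ys → All (x ≢_) ys
    private⇒fresh {ts} {t} {rest} {x} σ uniq ¬shared = All.map x≢
      where
      t∉rest : All (t ≢_) rest
      t∉rest = AllPairs.head (unique-↭ σ uniq)
      x≢ : ∀ {y} → EndpointIn rest y → x ≢ y
      x≢ ends refl with t′ , t′∈ , e ← find ends =
        ¬shared (lose (↭∷⇒⊆ σ t′∈) (≢-sym (All.lookup t∉rest t′∈) , e))

  distinctEndpoints : ∀ ts → Unique ts → TwoPrimitive (_∈ ts) → All Factored ts →
    ∃ λ ys → Unique ys × length ys ≡ length ts × All (EndpointIn ts) ys
  distinctEndpoints ts = go (length ts) ts refl
    where
    go : ∀ n ts → length ts ≡ n → Unique ts → TwoPrimitive (_∈ ts) → All Factored ts →
      ∃ λ ys → Unique ys × length ys ≡ length ts × All (EndpointIn ts) ys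
    go zero    []         _   _    _    _    = [] , [] , refl , []
    go (suc n) ts@(_ ∷ _) len uniq prim facs
      with t , t∈ , x , x∈t , ¬shared ← privateEndpoint prim facs (here refl)
      with rest , σ ← ∈⇒↭ t∈
      with ys , uniqYs , lenYs , endsYs ←
             go n rest (suc-injective (trans (sym (↭-length σ)) len))
                (AllPairs.tail (unique-↭ σ uniq))
                (twoPrimitive-⊆ prim (↭∷⇒⊆ σ))
                (All.tail (All-resp-↭ σ facs))
      = x ∷ ys
      , private⇒fresh σ uniq ¬shared endsYs ∷ uniqYs
      , trans (cong suc lenYs) (sym (↭-length σ))
      , lose t∈ x∈t ∷ All.map (Any-resp-⊆ (↭∷⇒⊆ σ)) endsYs

module Balance (Z : ℕ) where

  Small : ℕ → Set
  Small x = x * x ≤ Z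

  place : ℕ → ℕ × ℕ → ℕ × ℕ
  place r (a , b) with (r * a) * (r * a) ≤? Z
  ... | yes _ = r * a , b
  ... | no _  = a , r * b

  balance : List ℕ → ℕ × ℕ
  balance = foldr place (1 , 1)

  product-place : ∀ r a b → proj₁ (place r (a , b)) * proj₂ (place r (a , b)) ≡ r * (a * b)
  product-place r a b with (r * a) * (r * a) ≤? Z
  ... | yes _ = *-assoc r a b
  ... | no _  = x∙yz≈y∙xz a r b

  product-balance : ∀ rs → proj₁ (balance rs) * proj₂ (balance rs) ≡ product rs
  product-balance []       = refl
  product-balance (r ∷ rs) = trans (product-place r _ _) (cong (r *_) (product-balance rs))

  -- If neither r * a nor r * b were small, their product r * (r * (a * b)) would exceed Z.
  place-small : ∀ {r a b} → Small a → Small b → r * (r * (a * b)) ≤ Z →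
                Small (proj₁ (place r (a , b))) × Small (proj₂ (place r (a , b)))
  place-small {r} {a} {b} a-small b-small bound with (r * a) * (r * a) ≤? Z
  ... | yes ra-small = ra-small , b-small
  ... | no ra-large  = a-small , ≮⇒≥ λ Z<[rb]² → <-irrefl refl (begin-strict
    Z * Z                                       <⟨ *-mono-< (≰⇒> ra-large) Z<[rb]² ⟩
    (r * a) * (r * a) * ((r * b) * (r * b))     ≡⟨ regroup r a b ⟩
    r * (r * (a * b)) * (r * (r * (a * b)))     ≤⟨ *-mono-≤ bound bound ⟩
    Z * Z                                       ∎)
    where
    open ≤-Reasoning
    regroup : ∀ r a b → (r * a) * (r * a) * ((r * b) * (r * b)) ≡ r * (r * (a * b)) * (r * (r * (a * b)))
    regroup = solve-∀

  balance-small : ∀ {p} rs → 0 < p → All (λ r → 0 < r × r ≤ p) rs → p * product rs ≤ Z →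
                  Small (proj₁ (balance rs)) × Small (proj₂ (balance rs))
  balance-small {p} [] 0<p _ p≤Z = 1≤Z , 1≤Z
    where
    1≤Z : 1 ≤ Z
    1≤Z = ≤-trans 0<p (subst (_≤ Z) (*-identityʳ p) p≤Z)
  balance-small {p} (r ∷ rs) 0<p ((0<r , r≤p) ∷ bounds) bound =
    place-small {r} {proj₁ (balance rs)} {proj₂ (balance rs)} (proj₁ small) (proj₂ small)
      (subst (λ x → r * (r * x) ≤ Z) (sym (product-balance rs))
        (≤-trans (*-monoˡ-≤ (r * product rs) r≤p) bound))
    where
    small = balance-small rs 0<p bounds (≤-trans (*-monoʳ-≤ p (m≤n*m (product rs) r {{>-nonZero 0<r}})) bound)

module SmoothEndpoints {Z p : ℕ} .{{_ : NonZero p}} where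

  open Balance Z

  SmoothMultiple : ℕ → Set
  SmoothMultiple t = 0 < t × p ∣ t × Smooth p t × t ≤ Z

  halves : ℕ → ℕ × ℕ
  halves t = balance (primeFactors (t / p))

  open Endpoints p (proj₁ ∘ halves) (proj₂ ∘ halves)

  module _ {t} (multiple : SmoothMultiple t) where

    private
      0<t = proj₁ multiple
      p∣t = proj₁ (proj₂ multiple)
      t-smooth = proj₁ (proj₂ (proj₂ multiple))
      t≤Z = proj₂ (proj₂ (proj₂ multiple))
      m = t / p

      instance
        m≢0 : NonZero m
        m≢0 = >-nonZero (m≥n⇒m/n>0 (∣⇒≤ {{>-nonZero 0<t}} p∣t))

      t≡p*Πfactors : t ≡ p * product (primeFactors m)
      t≡p*Πfactors = trans (sym (m*[n/m]≡n p∣t)) (cong (p *_) (sym (product-primeFactors m)))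

    halves-factored : Factored t
    halves-factored = trans t≡p*Πfactors (cong (p *_) (sym (product-balance (primeFactors m))))

    halves-small : Small (proj₁ (halves t)) × Small (proj₂ (halves t))
    halves-small = balance-small (primeFactors m) (>-nonZero⁻¹ p) factor-bounds (subst (_≤ Z) t≡p*Πfactors t≤Z)
      where
      factor-bounds : All (λ r → 0 < r × r ≤ p) (primeFactors m)
      factor-bounds = All.tabulate λ {r} r∈ → let r-prime = All.lookup (primeFactors-prime m) r∈ in
        >-nonZero⁻¹ r {{prime⇒nonZero r-prime}} ,
        t-smooth r r-prime (∣-trans (subst (r ∣_) (product-primeFactors m) (∈⇒∣product r∈)) (m/n∣m p∣t))

  smoothEndpoints : ∀ xs → Unique xs → TwoPrimitive (_∈ xs) → All SmoothMultiple xs →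
    ∃ λ ys → Unique ys × length ys ≡ length xs × All (λ y → 0 < y × Small y × Smooth p y) ys
  smoothEndpoints xs uniq prim multiples
    with ys , uniqYs , lenYs , ends ← distinctEndpoints xs uniq prim (All.map halves-factored multiples)
    = ys , uniqYs , lenYs , All.map endpoint-bounds ends
    where
    endpoint-bounds : ∀ {y} → EndpointIn xs y → 0 < y × Small y × Smooth p y
    endpoint-bounds ends with t , t∈ , e ← find ends =
      let 0<t , _ , t-smooth , _ = multiple in ∣⇒>0 y∣t 0<t , small e , smooth-∣ y∣t t-smooth
      where
      multiple = All.lookup multiples t∈
      y∣t = endpoint-∣ (halves-factored multiple) e
      small : ∀ {y} → Endpoint t y → Small y
      small (inj₁ refl) = proj₁ (halves-small multiple)
      small (inj₂ refl) = proj₂ (halves-small multiple)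

module Multiples (Z : ℕ) (Ks : ℕ → List ℕ) where

  multiples : List ℕ → List ℕ
  multiples = concatMap (λ q → map (_* q) (Ks q))

  Admissible : ℕ → Set
  Admissible q = Prime q × Z < (q * q) * (q * q) × All (λ k → 0 < k × (k * q) * (k * q) ≤ Z) (Ks q)

  ∈-multiples⁻ : ∀ Q {w} → w ∈ multiples Q → ∃ λ q → q ∈ Q × ∃ λ k → k ∈ Ks q × w ≡ k * q
  ∈-multiples⁻ Q w∈ with q , q∈ , w∈q ← find (∈-concatMap⁻ (λ q → map (_* q) (Ks q)) {xs = Q} w∈)
                   with k , k∈ , w≡kq ← ∈-map⁻ (_* q) w∈q
    = q , q∈ , k , k∈ , w≡kq

  multiple-bounds : ∀ {Q} → All Admissible Q → ∀ {w} → w ∈ multiples Q →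
                    0 < w × w * w ≤ Z × Any (_∣ w) Q
  multiple-bounds {Q} admissibles w∈ with q , q∈ , k , k∈ , refl ← ∈-multiples⁻ Q w∈ =
    let q-prime , _ , multipliers-bounded = All.lookup admissibles q∈
        0<k , [kq]²≤Z = All.lookup multipliers-bounded k∈
    in *-mono-≤ 0<k (>-nonZero⁻¹ q {{prime⇒nonZero q-prime}}) , [kq]²≤Z , lose q∈ (n∣m*n k)

  length-multiples : ∀ Q → length (multiples Q) ≡ sum (map (length ∘ Ks) Q)
  length-multiples []      = refl
  length-multiples (q ∷ Q) =
    trans (length-++ (map (_* q) (Ks q))) (cong₂ _+_ (length-map (_* q) (Ks q)) (length-multiples Q))

  multiples-unique : (∀ q → Unique (Ks q)) → ∀ Q → Unique Q → All Admissible Q → Unique (multiples Q)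
  multiples-unique Ks-unique []      _               _                        = []
  multiples-unique Ks-unique (q ∷ Q) (q∉Q ∷ uniqQ) ((q-prime , Z<q⁴ , _) ∷ admissibles) =
    Unique.++⁺ (Unique.map⁺ (λ {k} {k′} → *-cancelʳ-≡ k k′ q {{prime⇒nonZero q-prime}}) (Ks-unique q))
               (multiples-unique Ks-unique Q uniqQ admissibles)
               disjoint
    where
    disjoint : ∀ {w} → ¬ (w ∈ map (_* q) (Ks q) × w ∈ multiples Q)
    disjoint (w∈q , w∈Q)
      with k , k∈ , refl ← ∈-map⁻ (_* q) w∈q
         | 0<w , w²≤Z , q′∣w ← multiple-bounds admissibles w∈Q
      with q′ , q′∈ , q′∣w ← find q′∣w
      = let q′-prime , Z<q′⁴ , _ = All.lookup admissibles q′∈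
        in All.lookup q∉Q q′∈ (largePrimeDivisor-unique q-prime q′-prime Z<q⁴ Z<q′⁴ (n∣m*n k) q′∣w 0<w w²≤Z)

smooth-nonSmooth-length²≤ : ∀ {Z p ys ws} → Unique ys → Unique ws →
  All (λ y → 0 < y × y * y ≤ Z × Smooth p y) ys → All (λ w → 0 < w × w * w ≤ Z × ¬ Smooth p w) ws →
  (length ys + length ws) * (length ys + length ws) ≤ Z
smooth-nonSmooth-length²≤ {ys = ys} {ws} uniqYs uniqWs ysBounds wsBounds =
  subst (λ n → n * n ≤ _) (length-++ ys)
    (length²≤ (ys ++ ws) (Unique.++⁺ uniqYs uniqWs disjoint)
      (All.++⁺ (All.map (λ (0<y , y²≤Z , _) → 0<y , y²≤Z) ysBounds)
               (All.map (λ (0<w , w²≤Z , _) → 0<w , w²≤Z) wsBounds)))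
  where
  disjoint : ∀ {v} → ¬ (v ∈ ys × v ∈ ws)
  disjoint (v∈ys , v∈ws) =
    let _ , _ , smooth = All.lookup ysBounds v∈ys
        _ , _ , nonSmooth = All.lookup wsBounds v∈ws
    in nonSmooth smooth

square : ∀ x → x ^ 2 ≡ x * x
square x = cong (x *_) (*-identityʳ x)

fourth : ∀ x → x ^ 4 ≡ (x * x) * (x * x)
fourth x = begin
  x ^ 4           ≡⟨ sym (^-*-assoc x 2 2) ⟩
  (x ^ 2) ^ 2     ≡⟨ square (x ^ 2) ⟩
  x ^ 2 * x ^ 2   ≡⟨ cong₂ _*_ (square x) (square x) ⟩
  x * x * (x * x) ∎
  where open ≡-Reasoning

⟦⟧≡mkℚ : ∀ n → ⟦ n ⟧ ≡ mkℚ (+ n) 0 (coprime-sym (1-coprimeTo n))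
⟦⟧≡mkℚ n = ℚ.normalize-coprime (coprime-sym (1-coprimeTo n))

⌊mkℚ⌋ : ∀ a d .(c : Coprime a (suc d)) → ⌊ mkℚ (+ a) d c ⌋ℕ ≡ a / suc d
⌊mkℚ⌋ a d _ = trans (ℤ.abs-◃ _ _) (*-identityˡ (a / suc d))

⟦⟧≤⇒≤⌊⌋ : ∀ n {z} → 0ℚ ≤ℚ z → ⟦ n ⟧ ≤ℚ z → n ≤ ⌊ z ⌋ℕ
⟦⟧≤⇒≤⌊⌋ n {mkℚ -[1+ _ ] _ _} (*≤* ()) _
⟦⟧≤⇒≤⌊⌋ n {mkℚ (+ a) d c} _ n≤z rewrite ⟦⟧≡mkℚ n | ⌊mkℚ⌋ a d c with *≤* n*[1+d]≤a*1 ← n≤z =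
  begin
    n                   ≡⟨ sym (m*n/n≡m n (suc d)) ⟩
    n * suc d / suc d   ≤⟨ /-monoˡ-≤ (suc d) (subst (n * suc d ≤_) (*-identityʳ a) n*[1+d]≤a) ⟩
    a / suc d           ∎
  where
  open ≤-Reasoning
  n*[1+d]≤a : n * suc d ≤ a * 1
  n*[1+d]≤a = ℤ.drop‿+≤+ (subst₂ ℤ._≤_ (sym (ℤ.pos-* n (suc d))) (sym (ℤ.pos-* a 1)) n*[1+d]≤a*1)

≤⌊⌋⇒⟦⟧≤ : ∀ n {z} → 0ℚ ≤ℚ z → n ≤ ⌊ z ⌋ℕ → ⟦ n ⟧ ≤ℚ z
≤⌊⌋⇒⟦⟧≤ n {mkℚ -[1+ _ ] _ _} (*≤* ()) _
≤⌊⌋⇒⟦⟧≤ n {mkℚ (+ a) d c} _ n≤⌊z⌋ rewrite ⟦⟧≡mkℚ n | ⌊mkℚ⌋ a d c =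
  *≤* (subst₂ ℤ._≤_ (ℤ.pos-* n (suc d)) (ℤ.pos-* a 1) (ℤ.+≤+ n*[1+d]≤a*1))
  where
  n*[1+d]≤a*1 : n * suc d ≤ a * 1
  n*[1+d]≤a*1 = subst (n * suc d ≤_) (sym (*-identityʳ a))
    (≤-trans (*-monoˡ-≤ (suc d) n≤⌊z⌋) (m/n*n≤m a (suc d)))

<⟦⟧⇒⌊⌋< : ∀ n {z} → 0ℚ ≤ℚ z → z <ℚ ⟦ n ⟧ → ⌊ z ⌋ℕ < n
<⟦⟧⇒⌊⌋< n 0≤z z<n = ≰⇒> λ n≤⌊z⌋ → ℚ.<-irrefl refl (ℚ.<-≤-trans z<n (≤⌊⌋⇒⟦⟧≤ n 0≤z n≤⌊z⌋))

∈-map-suc⇒>0 : ∀ {k xs} → k ∈ map suc xs → 0 < k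
∈-map-suc⇒>0 k∈ with _ , _ , refl ← ∈-map⁻ suc k∈ = s≤s z≤n

multipliers : ℚ → ℕ → List ℕ
multipliers z q = filter (λ k → ⟦ (k * q) ^ 2 ⟧ ℚ.≤? z) (map suc (upTo ⌊ z ⌋ℕ))

module _ (p : ℕ) (z : ℚ) (0≤z : 0ℚ ≤ℚ z) where

  open Multiples ⌊ z ⌋ℕ (multipliers z)

  private
    Z = ⌊ z ⌋ℕ

    inI? : ∀ q → Dec (Prime q × p < q × z <ℚ ⟦ q ^ 4 ⟧ × ⟦ q ^ 2 ⟧ <ℚ z)
    inI? q = prime? q ×-dec (p <? q) ×-dec (z ℚ.<? ⟦ q ^ 4 ⟧) ×-dec (⟦ q ^ 2 ⟧ ℚ.<? z)

    multiplier? : ∀ q k → Dec (⟦ (k * q) ^ 2 ⟧ ≤ℚ z)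
    multiplier? q k = ⟦ (k * q) ^ 2 ⟧ ℚ.≤? z

  primeInI-admissible : ∀ {q} → q ∈ primesInI p z → Admissible q × p < q
  primeInI-admissible {q} q∈ =
    let q-prime , p<q , z<q⁴ , _ = proj₂ (∈-filter⁻ inI? {xs = upTo (suc Z)} q∈)
    in (q-prime , subst (Z <_) (fourth q) (<⟦⟧⇒⌊⌋< (q ^ 4) 0≤z z<q⁴) , All.tabulate multiplier-bounds) , p<q
    where
    multiplier-bounds : ∀ {k} → k ∈ multipliers z q → 0 < k × (k * q) * (k * q) ≤ Z
    multiplier-bounds {k} k∈ =
      let k∈range , [kq]²≤z = ∈-filter⁻ (multiplier? q) {xs = map suc (upTo Z)} k∈
      in ∈-map-suc⇒>0 k∈range , subst (_≤ Z) (square (k * q)) (⟦⟧≤⇒≤⌊⌋ ((k * q) ^ 2) 0≤z [kq]²≤z)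

  largePrimeMultiples : Unique (multiples (primesInI p z)) ×
    length (multiples (primesInI p z)) ≡ sumI p z ×
    All (λ w → 0 < w × w * w ≤ Z × ¬ Smooth p w) (multiples (primesInI p z))
  largePrimeMultiples =
    multiples-unique (λ q → Unique.filter⁺ (multiplier? q) (Unique.map⁺ suc-injective (Unique.upTo⁺ Z)))
                     Q (Unique.filter⁺ inI? (Unique.upTo⁺ (suc Z))) admissibles ,
    length-multiples Q ,
    All.tabulate λ w∈ → let 0<w , w²≤Z , q∣w = multiple-bounds admissibles w∈ in 0<w , w²≤Z , nonSmooth q∣w
    where
    Q = primesInI p z
    admissibles : All Admissible Q
    admissibles = All.tabulate (proj₁ ∘ primeInI-admissible)
    nonSmooth : ∀ {w} → Any (_∣ w) Q → ¬ Smooth p w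
    nonSmooth q∣w smooth =
      let q , q∈ , q∣w = find q∣w
          (q-prime , _) , p<q = primeInI-admissible q∈
      in <⇒≱ p<q (smooth q q-prime q∣w)

lemma3p5 : (T : ℕ → Set) → AllGt1 T → AtLeast3 T → TwoPrimitive T →
    (p : ℕ) → Prime p → (z : ℚ) → 1ℚ <ℚ z →
    (xs : List ℕ) → Unique xs →
    All (λ t → T t × GreatestPrimeFactor t p × ⟦ t ⟧ ≤ℚ z) xs →
    ⟦ (length xs + sumI p z) ^ 2 ⟧ ≤ℚ z
lemma3p5 T gt1 _ tp p p-prime z 1<z xs uniq members =
  ≤⌊⌋⇒⟦⟧≤ (n ^ 2) 0≤z (subst (_≤ ⌊ z ⌋ℕ) (sym (square n)) n²≤Z)
  where
  n = length xs + sumI p z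
  instance
    _ = prime⇒nonZero p-prime
  open SmoothEndpoints {⌊ z ⌋ℕ} {p} using (SmoothMultiple; smoothEndpoints)

  0≤z : 0ℚ ≤ℚ z
  0≤z = ℚ.≤-trans (ℚ.nonNegative⁻¹ 1ℚ) (ℚ.<⇒≤ 1<z)

  smoothMultiple : ∀ {t} → T t × GreatestPrimeFactor t p × ⟦ t ⟧ ≤ℚ z → SmoothMultiple t
  smoothMultiple {t} (Tt , (_ , p∣t , greatest) , t≤z) = <⇒≤ (gt1 t Tt) , p∣t , greatest , ⟦⟧≤⇒≤⌊⌋ t 0≤z t≤z

  n²≤Z : n * n ≤ ⌊ z ⌋ℕ
  n²≤Z =
    let ys , uniqYs , lenYs , ysBounds = smoothEndpoints xs uniq
              (twoPrimitive-⊆ tp (proj₁ ∘ All.lookup members)) (All.map smoothMultiple members)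
        uniqWs , lenWs , wsBounds = largePrimeMultiples p z 0≤z
    in subst (λ n → n * n ≤ ⌊ z ⌋ℕ) (cong₂ _+_ lenYs lenWs)
         (smooth-nonSmooth-length²≤ uniqYs uniqWs ysBounds wsBounds)
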